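{- Let $b,c$ be rational numbers with $\Delta\,(bc-1-b)(bc-c-2b)\neq 0$ (where $\Delta$ is as in the context), and suppose $bc^2-4bc+4b+2=0$. Then both cubic polynomials $P(x)$ and $Q(d)$ (defined in the context) are reducible over $\mathbb{Q}$; in this case $P$ has the root $x=0$ and $Q$ has the root $d=-1$.
   Context: Let $b,c$ be rational numbers. Put $\Delta=b^2c^4-6b^2c^3+13b^2c^2-12b^2c+4b^2+c^2$ and, when $\Delta\,(bc-1-b)(bc-c-2b)\neq 0$, define (with $D=b^2c^2+2b^2-3b^2c+c-bc^2+2b$): $E_{01}=-\frac{b(c^2+2-2c)}{D}$, $E_{10}=-\frac{b^2c^2+2b^2-3b^2c-c}{D}$; $E_{20}=\frac{b}{2}(bc^2-2c-2b)(2bc^2-c^2-6bc+2+4b)(bc-1-b)^{ -2}(bc-c-2b)^{ -2}$; $E_{02}=\frac12(28b^2c^2-16b^2c-2c^2-4b^2-b^2c^4+4b^3c^4-12b^3c^3+4bc^3+24b^3c-8bc-2b^4c^4+12b^4c^3-26b^4c^2-8b^2c^3+24b^4c-16b^3-8b^4)(bc-1-b)^{ -2}(bc-c-2b)^{ -2}$; $E_{03}=\frac{b}{2}(b^2c^4-5b^2c^3+10b^2c^2-10b^2c+4b^2+2bc+2c^2-bc^3)(2b^2c^4-12b^2c^3+26b^2c^2-24b^2c+8b^2-c^4b+3bc^3-6bc+4b+c^3-2c^2+2c)\,\Delta^{ -1}(bc-1-b)^{ -2}(bc-c-2b)^{ -2}$; $E_{30}=c\,b^2(1-c)(c-2)(bc^2-4bc+2+4b)(2bc^2-c^2-4bc+2b)\,\Delta^{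 -1}(bc-1-b)^{ -2}(bc-c-2b)^{ -2}$. Define $P(x)=x^3-E_{10}x^2+E_{20}x-E_{30}$ and $Q(d)=d^3-E_{01}d^2+E_{02}d-E_{03}$. -}

module Defs where

open import Data.Nat using (ℕ; zero; suc; _≤_)
open import Data.Integer using (+_)
open import Data.Rational using (ℚ; 0ℚ; 1ℚ; _+_; _*_; _-_; -_; 1/_; ≢-nonZero)
import Data.Rational as ℚ
open import Data.Rational.Properties using (_≟_)
open import Data.List using (List; []; _∷_; map; length)
open import Data.Product using (Σ; _×_; ∃)
open import Relation.Nullary using (¬_; yes; no)
open import Relation.Binary.PropositionalEquality using (_≡_)

ι : ℕ → ℚ
ι n = (+ n) ℚ./ 1

half : ℚ
half = (+ 1) ℚ./ 2

-- total inverse: inv 0 = 0 (only ever applied to nonzero arguments under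
-- the hypotheses of the theorem)
inv : ℚ → ℚ
inv p with p ≟ 0ℚ
... | yes _  = 0ℚ
... | no p≢0 = 1/_ p {{≢-nonZero p≢0}}

sq : ℚ → ℚ
sq x = x * x

-- Polynomials over ℚ as coefficient lists, constant term first

Poly : Set
Poly = List ℚ

_⊕_ : Poly → Poly → Poly
[] ⊕ q = q
(a ∷ p) ⊕ [] = a ∷ p
(a ∷ p) ⊕ (b ∷ q) = (a + b) ∷ (p ⊕ q)

_⊛_ : Poly → Poly → Poly
[] ⊛ q = []
(a ∷ p) ⊛ q = map (a *_) q ⊕ (0ℚ ∷ (p ⊛ q))

lead : Poly → ℚ
lead [] = 0ℚ
lead (a ∷ []) = a
lead (a ∷ b ∷ p) = lead (b ∷ p)

eval : Poly → ℚ → ℚ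
eval [] x = 0ℚ
eval (a ∷ p) x = a + x * eval p x

NonConstant : Poly → Set
NonConstant f = (2 ≤ length f) × ¬ (lead f ≡ 0ℚ)

Reducible : Poly → Set
Reducible p = Σ Poly λ f → Σ Poly λ g →
  NonConstant f × NonConstant g × (f ⊛ g ≡ p)

cubic : ℚ → ℚ → ℚ → Poly
cubic s1 s2 s3 = (- s3) ∷ s2 ∷ (- s1) ∷ 1ℚ ∷ []

module _ (b c : ℚ) where

  Δ : ℚ
  Δ = sq b * (sq c * sq c) - ι 6 * sq b * (c * sq c) + ι 13 * sq b * sq c
      - ι 12 * sq b * c + ι 4 * sq b + sq c

  F₁ : ℚ
  F₁ = b * c - 1ℚ - b

  F₂ : ℚ
  F₂ = b * c - c - ι 2 * b

  D : ℚ
  D = sq b * sq c + ι 2 * sq b - ι 3 * sq b * c + c - b * sq c + ι 2 * b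

  W : ℚ
  W = inv (sq F₁) * inv (sq F₂)

  E₀₁ : ℚ
  E₀₁ = - (b * (sq c + ι 2 - ι 2 * c) * inv D)

  E₁₀ : ℚ
  E₁₀ = - ((sq b * sq c + ι 2 * sq b - ι 3 * sq b * c - c) * inv D)

  E₂₀ : ℚ
  E₂₀ = b * half * (b * sq c - ι 2 * c - ι 2 * b)
        * (ι 2 * b * sq c - sq c - ι 6 * b * c + ι 2 + ι 4 * b) * W

  E₀₂ : ℚ
  E₀₂ = half * (ι 28 * sq b * sq c - ι 16 * sq b * c - ι 2 * sq c - ι 4 * sq b
               - sq b * (sq c * sq c) + ι 4 * (b * sq b) * (sq c * sq c)
               - ι 12 * (b * sq b) * (c * sq c) + ι 4 * b * (c * sq c)
               + ι 24 * (b * sq b) * c - ι 8 * b * c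
               - ι 2 * (sq b * sq b) * (sq c * sq c)
               + ι 12 * (sq b * sq b) * (c * sq c)
               - ι 26 * (sq b * sq b) * sq c - ι 8 * sq b * (c * sq c)
               + ι 24 * (sq b * sq b) * c - ι 16 * (b * sq b)
               - ι 8 * (sq b * sq b)) * W

  E₀₃ : ℚ
  E₀₃ = b * half
        * (sq b * (sq c * sq c) - ι 5 * sq b * (c * sq c) + ι 10 * sq b * sq c
           - ι 10 * sq b * c + ι 4 * sq b + ι 2 * b * c + ι 2 * sq c
           - b * (c * sq c))
        * (ι 2 * sq b * (sq c * sq c) - ι 12 * sq b * (c * sq c)
           + ι 26 * sq b * sq c - ι 24 * sq b * c + ι 8 * sq b
           - (sq c * sq c) * b + ι 3 * b * (c * sq c) - ι 6 * b * c + ι 4 * b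
           + c * sq c - ι 2 * sq c + ι 2 * c)
        * inv Δ * W

  E₃₀ : ℚ
  E₃₀ = c * sq b * (1ℚ - c) * (c - ι 2)
        * (b * sq c - ι 4 * b * c + ι 2 + ι 4 * b)
        * (ι 2 * b * sq c - sq c - ι 4 * b * c + ι 2 * b)
        * inv Δ * W

  P : Poly
  P = cubic E₁₀ E₂₀ E₃₀

  Q : Poly
  Q = cubic E₀₁ E₀₂ E₀₃

-- P(0) = -E₃₀, and h = bc² - 4bc + 4b + 2 is (up to reordering) a factor of E₃₀.
-- For Q, clearing the denominators D, Δ, F₁², F₂² turns Q(-1) into a polynomial in
-- b, c, which factors as -h²b²c²(c-1)²F₁F₂; here D ≠ 0 because D(c-2)³ ≡ ((c-1)² + 1)²
-- modulo h and (c-1)² + 1 has no rational root. A monic cubic with a rational root r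
-- splits off the factor X - r.

module Submission where

open import Defs
open import Algebra.Bundles using (CommutativeMonoid)
open import Data.Fin using (zero; suc)
open import Data.List using ([]; _∷_)
open import Data.Nat using (ℕ; s≤s; z≤n)
open import Data.Product using (_×_; _,_)
open import Data.Rational
  using (ℚ; 0ℚ; 1ℚ; _+_; _*_; _-_; -_; NonNegative; ≢-nonZero; nonNegative; nonPositive)
open import Data.Rational.Properties
  using (_≟_; ≤-total; <-irrefl; positive⁻¹; *-inverseˡ; *-identityʳ; *-assoc; *-comm;
         *-zeroˡ; *-zeroʳ; +-identityʳ; 1≢0; *-1-commutativeMonoid;
         nonNeg*nonNeg⇒nonNeg; nonPos*nonPos⇒nonPos; nonNeg+pos⇒pos)
open import Data.Rational.Solver using (module +-*-Solver)
open import Data.Sum using (inj₁; inj₂)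
open import Data.Vec using ([]; _∷_)
open import Relation.Nullary using (¬_; yes; no; contradiction)
open import Relation.Binary.PropositionalEquality
  using (_≡_; _≢_; refl; sym; trans; cong; cong₂; module ≡-Reasoning)
open import Algebra.Properties.CommutativeSemigroup
  (CommutativeMonoid.commutativeSemigroup *-1-commutativeMonoid)
  using () renaming (interchange to *-interchange)

open +-*-Solver using (solve; Polynomial; ⟦_⟧; var; _:+_; _:-_; _:*_; :-_; con; _:=_)
open ≡-Reasoning

inv-inverseˡ : ∀ {p} → p ≢ 0ℚ → inv p * p ≡ 1ℚ
inv-inverseˡ {p} p≢0 with p ≟ 0ℚ
... | yes p≡0 = contradiction p≡0 p≢0
... | no  _   = *-inverseˡ p {{≢-nonZero p≢0}}

inv-*-inverseˡ : ∀ {p q} → p ≢ 0ℚ → q ≢ 0ℚ → inv p * inv q * (p * q) ≡ 1ℚ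
inv-*-inverseˡ {p} {q} p≢0 q≢0 = begin
  inv p * inv q * (p * q)   ≡⟨ *-interchange (inv p) (inv q) p q ⟩
  inv p * p * (inv q * q)   ≡⟨ cong₂ _*_ (inv-inverseˡ p≢0) (inv-inverseˡ q≢0) ⟩
  1ℚ * 1ℚ                   ∎

p*q≡0⇒p≡0 : ∀ {p q} → q ≢ 0ℚ → p * q ≡ 0ℚ → p ≡ 0ℚ
p*q≡0⇒p≡0 {p} {q} q≢0 pq≡0 = begin
  p                 ≡⟨ sym (*-identityʳ p) ⟩
  p * 1ℚ            ≡⟨ cong (p *_) (sym (inv-inverseˡ q≢0)) ⟩
  p * (inv q * q)   ≡⟨ cong (p *_) (*-comm (inv q) q) ⟩
  p * (q * inv q)   ≡⟨ sym (*-assoc p q (inv q)) ⟩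
  p * q * inv q     ≡⟨ cong (_* inv q) pq≡0 ⟩
  0ℚ * inv q        ≡⟨ *-zeroˡ (inv q) ⟩
  0ℚ                ∎

p≡0⇒p*q≡0 : ∀ {p} q → p ≡ 0ℚ → p * q ≡ 0ℚ
p≡0⇒p*q≡0 q refl = *-zeroˡ q

p*q≢0 : ∀ {p q} → p ≢ 0ℚ → q ≢ 0ℚ → p * q ≢ 0ℚ
p*q≢0 p≢0 q≢0 pq≡0 = p≢0 (p*q≡0⇒p≡0 q≢0 pq≡0)

p*q≢0⇒p≢0 : ∀ {p} q → p * q ≢ 0ℚ → p ≢ 0ℚ
p*q≢0⇒p≢0 q pq≢0 refl = pq≢0 (*-zeroˡ q)

p*q≢0⇒q≢0 : ∀ p {q} → p * q ≢ 0ℚ → q ≢ 0ℚ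
p*q≢0⇒q≢0 p pq≢0 refl = pq≢0 (*-zeroʳ p)

p*p-nonNeg : ∀ p → NonNegative (p * p)
p*p-nonNeg p with ≤-total 0ℚ p
... | inj₁ 0≤p = nonNeg*nonNeg⇒nonNeg p {{nonNegative 0≤p}} p {{nonNegative 0≤p}}
... | inj₂ p≤0 = nonPos*nonPos⇒nonPos p {{nonPositive p≤0}} p {{nonPositive p≤0}}

p*p+1≢0 : ∀ p → p * p + 1ℚ ≢ 0ℚ
p*p+1≢0 p eq = <-irrefl (sym eq) (positive⁻¹ _ {{nonNeg+pos⇒pos (p * p) {{p*p-nonNeg p}} 1ℚ}})

eval-cubic-at-0 : ∀ s₁ s₂ s₃ → eval (cubic s₁ s₂ s₃) 0ℚ ≡ - s₃
eval-cubic-at-0 s₁ s₂ s₃ = solve 3 (λ s₁ s₂ s₃ →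
  :- s₃ :+ con 0ℚ :* (s₂ :+ con 0ℚ :* (:- s₁ :+ con 0ℚ :* (con 1ℚ :+ con 0ℚ :* con 0ℚ)))
  := :- s₃) refl s₁ s₂ s₃

cubic≡linear⊛quadratic : ∀ {s₁ s₂ s₃} r → eval (cubic s₁ s₂ s₃) r ≡ 0ℚ →
  cubic s₁ s₂ s₃ ≡ (- r ∷ 1ℚ ∷ []) ⊛ (r * (r - s₁) + s₂ ∷ r - s₁ ∷ 1ℚ ∷ [])
cubic≡linear⊛quadratic {s₁} {s₂} {s₃} r root =
  cong₂ _∷_ constant (cong₂ _∷_ (linear s₁ s₂ r) (cong₂ _∷_ (quadratic s₁ r) refl))
  where
  constant : - s₃ ≡ - r * (r * (r - s₁) + s₂) + 0ℚ
  constant = begin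
    - s₃                                     ≡⟨ sym (+-identityʳ (- s₃)) ⟩
    - s₃ - 0ℚ                                ≡⟨ cong (λ v → - s₃ - v) (sym root) ⟩
    - s₃ - eval (cubic s₁ s₂ s₃) r           ≡⟨ remainder s₁ s₂ s₃ r ⟩
    - r * (r * (r - s₁) + s₂) + 0ℚ           ∎
    where
    remainder : ∀ s₁ s₂ s₃ r →
      - s₃ - eval (cubic s₁ s₂ s₃) r ≡ - r * (r * (r - s₁) + s₂) + 0ℚ
    remainder = solve 4 (λ s₁ s₂ s₃ r →
      :- s₃ :- (:- s₃ :+ r :* (s₂ :+ r :* (:- s₁ :+ r :* (con 1ℚ :+ r :* con 0ℚ))))
      := :- r :* (r :* (r :- s₁) :+ s₂) :+ con 0ℚ) refl
  linear : ∀ s₁ s₂ r → s₂ ≡ - r * (r - s₁) + (1ℚ * (r * (r - s₁) + s₂) + 0ℚ)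
  linear = solve 3 (λ s₁ s₂ r →
    s₂ := :- r :* (r :- s₁) :+ (con 1ℚ :* (r :* (r :- s₁) :+ s₂) :+ con 0ℚ)) refl
  quadratic : ∀ s₁ r → - s₁ ≡ - r * 1ℚ + 1ℚ * (r - s₁)
  quadratic = solve 2 (λ s₁ r → :- s₁ := :- r :* con 1ℚ :+ con 1ℚ :* (r :- s₁)) refl

cubic-root⇒reducible : ∀ {s₁ s₂ s₃} r → eval (cubic s₁ s₂ s₃) r ≡ 0ℚ → Reducible (cubic s₁ s₂ s₃)
cubic-root⇒reducible {s₁} {s₂} r root =
  (- r ∷ 1ℚ ∷ []) , (r * (r - s₁) + s₂ ∷ r - s₁ ∷ 1ℚ ∷ []) ,
  (s≤s (s≤s z≤n) , 1≢0) , (s≤s (s≤s z≤n) , 1≢0) , sym (cubic≡linear⊛quadratic r root)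

cubic-at-minus-one-cleared : ∀ n₁ n₂ n₃ {d δ f x y ω} → x * d ≡ 1ℚ → y * δ ≡ 1ℚ → ω * f ≡ 1ℚ →
  eval (cubic (- (n₁ * x)) (n₂ * ω) (n₃ * y * ω)) (- 1ℚ) * (d * δ * f)
    ≡ n₁ * δ * f - n₂ * d * δ - n₃ * d - d * δ * f
cubic-at-minus-one-cleared n₁ n₂ n₃ {d} {δ} {f} {x} {y} {ω} x*d≡1 y*δ≡1 ω*f≡1 = begin
  eval (cubic (- (n₁ * x)) (n₂ * ω) (n₃ * y * ω)) (- 1ℚ) * (d * δ * f)
    ≡⟨ expand ⟩
  R (x * d) (y * δ) (ω * f)   ≡⟨ cong₂ (λ u v → R u v (ω * f)) x*d≡1 y*δ≡1 ⟩
  R 1ℚ 1ℚ (ω * f)             ≡⟨ cong (R 1ℚ 1ℚ) ω*f≡1 ⟩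
  R 1ℚ 1ℚ 1ℚ                  ≡⟨ drop-units ⟩
  n₁ * δ * f - n₂ * d * δ - n₃ * d - d * δ * f ∎
  where
  R : ℚ → ℚ → ℚ → ℚ
  R u v w = n₁ * u * δ * f - n₂ * d * δ * w - n₃ * d * v * w - d * δ * f

  expand : eval (cubic (- (n₁ * x)) (n₂ * ω) (n₃ * y * ω)) (- 1ℚ) * (d * δ * f)
           ≡ R (x * d) (y * δ) (ω * f)
  expand = solve 9 (λ n₁ n₂ n₃ d δ f x y ω →
    (:- (n₃ :* y :* ω) :+ con (- 1ℚ) :* (n₂ :* ω :+ con (- 1ℚ) :* (:- (:- (n₁ :* x))
      :+ con (- 1ℚ) :* (con 1ℚ :+ con (- 1ℚ) :* con 0ℚ)))) :* (d :* δ :* f)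
    := n₁ :* (x :* d) :* δ :* f :- n₂ :* d :* δ :* (ω :* f)
       :- n₃ :* d :* (y :* δ) :* (ω :* f) :- d :* δ :* f) refl n₁ n₂ n₃ d δ f x y ω

  drop-units : R 1ℚ 1ℚ 1ℚ ≡ n₁ * δ * f - n₂ * d * δ - n₃ * d - d * δ * f
  drop-units = solve 6 (λ n₁ n₂ n₃ d δ f →
    n₁ :* con 1ℚ :* δ :* f :- n₂ :* d :* δ :* con 1ℚ :- n₃ :* d :* con 1ℚ :* con 1ℚ :- d :* δ :* f
    := n₁ :* δ :* f :- n₂ :* d :* δ :- n₃ :* d :- d :* δ :* f) refl n₁ n₂ n₃ d δ f

-- Solver syntax for the polynomials of Defs: ⟦ Xˢ b c ⟧ reduces to X b c.
module Syntax {n} (b c : Polynomial n) where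

  κ : ℕ → Polynomial n
  κ k = con (ι k)

  sqˢ : Polynomial n → Polynomial n
  sqˢ x = x :* x

  Δˢ F₁ˢ F₂ˢ Dˢ N₀₁ˢ N₀₂ˢ N₀₃ˢ hˢ : Polynomial n
  Δˢ = sqˢ b :* (sqˢ c :* sqˢ c) :- κ 6 :* sqˢ b :* (c :* sqˢ c) :+ κ 13 :* sqˢ b :* sqˢ c
       :- κ 12 :* sqˢ b :* c :+ κ 4 :* sqˢ b :+ sqˢ c
  F₁ˢ = b :* c :- con 1ℚ :- b
  F₂ˢ = b :* c :- c :- κ 2 :* b
  Dˢ = sqˢ b :* sqˢ c :+ κ 2 :* sqˢ b :- κ 3 :* sqˢ b :* c :+ c :- b :* sqˢ c :+ κ 2 :* b
  N₀₁ˢ = b :* (sqˢ c :+ κ 2 :- κ 2 :* c)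
  N₀₂ˢ = con half :* (κ 28 :* sqˢ b :* sqˢ c :- κ 16 :* sqˢ b :* c :- κ 2 :* sqˢ c :- κ 4 :* sqˢ b
               :- sqˢ b :* (sqˢ c :* sqˢ c) :+ κ 4 :* (b :* sqˢ b) :* (sqˢ c :* sqˢ c)
               :- κ 12 :* (b :* sqˢ b) :* (c :* sqˢ c) :+ κ 4 :* b :* (c :* sqˢ c)
               :+ κ 24 :* (b :* sqˢ b) :* c :- κ 8 :* b :* c
               :- κ 2 :* (sqˢ b :* sqˢ b) :* (sqˢ c :* sqˢ c)
               :+ κ 12 :* (sqˢ b :* sqˢ b) :* (c :* sqˢ c)
               :- κ 26 :* (sqˢ b :* sqˢ b) :* sqˢ c :- κ 8 :* sqˢ b :* (c :* sqˢ c)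
               :+ κ 24 :* (sqˢ b :* sqˢ b) :* c :- κ 16 :* (b :* sqˢ b)
               :- κ 8 :* (sqˢ b :* sqˢ b))
  N₀₃ˢ = b :* con half
        :* (sqˢ b :* (sqˢ c :* sqˢ c) :- κ 5 :* sqˢ b :* (c :* sqˢ c) :+ κ 10 :* sqˢ b :* sqˢ c
           :- κ 10 :* sqˢ b :* c :+ κ 4 :* sqˢ b :+ κ 2 :* b :* c :+ κ 2 :* sqˢ c
           :- b :* (c :* sqˢ c))
        :* (κ 2 :* sqˢ b :* (sqˢ c :* sqˢ c) :- κ 12 :* sqˢ b :* (c :* sqˢ c)
           :+ κ 26 :* sqˢ b :* sqˢ c :- κ 24 :* sqˢ b :* c :+ κ 8 :* sqˢ b
           :- (sqˢ c :* sqˢ c) :* b :+ κ 3 :* b :* (c :* sqˢ c) :- κ 6 :* b :* c :+ κ 4 :* b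
           :+ c :* sqˢ c :- κ 2 :* sqˢ c :+ κ 2 :* c)
  hˢ = b :* sqˢ c :- κ 4 :* b :* c :+ κ 4 :* b :+ κ 2

-- Numerators of the context: E₀₁ = -N₀₁/D, E₀₂ = N₀₂ W and E₀₃ = N₀₃ W/Δ hold definitionally.
N₀₁ N₀₂ N₀₃ : ℚ → ℚ → ℚ
N₀₁ b c = ⟦ Syntax.N₀₁ˢ (var zero) (var (suc zero)) ⟧ (b ∷ c ∷ [])
N₀₂ b c = ⟦ Syntax.N₀₂ˢ (var zero) (var (suc zero)) ⟧ (b ∷ c ∷ [])
N₀₃ b c = ⟦ Syntax.N₀₃ˢ (var zero) (var (suc zero)) ⟧ (b ∷ c ∷ [])

h : ℚ → ℚ → ℚ
h b c = b * sq c - ι 4 * b * c + ι 4 * b + ι 2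

numerator-factorisation : ∀ b c →
  N₀₁ b c * Δ b c * (sq (F₁ b c) * sq (F₂ b c)) - N₀₂ b c * D b c * Δ b c - N₀₃ b c * D b c
    - D b c * Δ b c * (sq (F₁ b c) * sq (F₂ b c))
  ≡ h b c * - (h b c * sq (b * c * (c - 1ℚ)) * F₁ b c * F₂ b c)
numerator-factorisation = solve 2 (λ b c → let open Syntax b c in
  N₀₁ˢ :* Δˢ :* (sqˢ F₁ˢ :* sqˢ F₂ˢ) :- N₀₂ˢ :* Dˢ :* Δˢ :- N₀₃ˢ :* Dˢ
    :- Dˢ :* Δˢ :* (sqˢ F₁ˢ :* sqˢ F₂ˢ)
  := hˢ :* :- (hˢ :* sqˢ (b :* c :* (c :- con 1ℚ)) :* F₁ˢ :* F₂ˢ)) refl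

Q-at-minus-one-cleared : ∀ b c → D b c ≢ 0ℚ → Δ b c ≢ 0ℚ → F₁ b c ≢ 0ℚ → F₂ b c ≢ 0ℚ →
  eval (Q b c) (- 1ℚ) * (D b c * Δ b c * (sq (F₁ b c) * sq (F₂ b c)))
    ≡ h b c * - (h b c * sq (b * c * (c - 1ℚ)) * F₁ b c * F₂ b c)
Q-at-minus-one-cleared b c D≢0 Δ≢0 F₁≢0 F₂≢0 =
  trans (cubic-at-minus-one-cleared (N₀₁ b c) (N₀₂ b c) (N₀₃ b c) (inv-inverseˡ D≢0) (inv-inverseˡ Δ≢0)
           (inv-*-inverseˡ (p*q≢0 F₁≢0 F₁≢0) (p*q≢0 F₂≢0 F₂≢0)))
        (numerator-factorisation b c)

D-cube-identity : ∀ b c → D b c * ((c - ι 2) * (c - ι 2) * (c - ι 2))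
  ≡ sq ((c - 1ℚ) * (c - 1ℚ) + 1ℚ)
    + h b c * (b * (c - ι 2) * (c - ι 2) * (c - 1ℚ) - (c * c * c - ι 2 * c * c + ι 2))
D-cube-identity = solve 2 (λ b c → let open Syntax b c in
  Dˢ :* ((c :- κ 2) :* (c :- κ 2) :* (c :- κ 2))
  := sqˢ ((c :- con 1ℚ) :* (c :- con 1ℚ) :+ con 1ℚ)
     :+ hˢ :* (b :* (c :- κ 2) :* (c :- κ 2) :* (c :- con 1ℚ) :- (c :* c :* c :- κ 2 :* c :* c :+ κ 2)))
  refl

D≢0 : ∀ b c → h b c ≡ 0ℚ → D b c ≢ 0ℚ
D≢0 b c h≡0 D≡0 = p*q≢0 g≢0 g≢0 (begin
  sq g              ≡⟨ sym (+-identityʳ (sq g)) ⟩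
  sq g + 0ℚ         ≡⟨ cong (sq g +_) (sym (p≡0⇒p*q≡0 M h≡0)) ⟩
  sq g + h b c * M  ≡⟨ sym (D-cube-identity b c) ⟩
  D b c * t³        ≡⟨ cong (_* t³) D≡0 ⟩
  0ℚ * t³           ≡⟨ *-zeroˡ t³ ⟩
  0ℚ                ∎)
  where
  g M t³ : ℚ
  g = (c - 1ℚ) * (c - 1ℚ) + 1ℚ
  M = b * (c - ι 2) * (c - ι 2) * (c - 1ℚ) - (c * c * c - ι 2 * c * c + ι 2)
  t³ = (c - ι 2) * (c - ι 2) * (c - ι 2)
  g≢0 : g ≢ 0ℚ
  g≢0 = p*p+1≢0 (c - 1ℚ)

E₃₀≡0 : ∀ b c → h b c ≡ 0ℚ → E₃₀ b c ≡ 0ℚ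
E₃₀≡0 b c h≡0 = trans (factor-out x h′ y (inv (Δ b c)) (W b c)) (p≡0⇒p*q≡0 _ h′≡0)
  where
  x h′ y : ℚ
  x = c * sq b * (1ℚ - c) * (c - ι 2)
  h′ = b * sq c - ι 4 * b * c + ι 2 + ι 4 * b
  y = ι 2 * b * sq c - sq c - ι 4 * b * c + ι 2 * b

  factor-out : ∀ x v y z w → x * v * y * z * w ≡ v * (x * y * z * w)
  factor-out = solve 5 (λ x v y z w → x :* v :* y :* z :* w := v :* (x :* y :* z :* w)) refl

  h′≡0 : h′ ≡ 0ℚ
  h′≡0 = trans (solve 2 (λ b c → let open Syntax b c in
    b :* sqˢ c :- κ 4 :* b :* c :+ κ 2 :+ κ 4 :* b := hˢ) refl b c) h≡0

theorem6p1 : (b c : ℚ) →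
    ¬ (Δ b c * F₁ b c * F₂ b c ≡ 0ℚ) →
    b * sq c - ι 4 * b * c + ι 4 * b + ι 2 ≡ 0ℚ →
    Reducible (P b c) × Reducible (Q b c)
    × eval (P b c) 0ℚ ≡ 0ℚ × eval (Q b c) (- 1ℚ) ≡ 0ℚ
theorem6p1 b c Δ*F₁*F₂≢0 h≡0 =
  cubic-root⇒reducible 0ℚ P-at-0 , cubic-root⇒reducible (- 1ℚ) Q-at-minus-one , P-at-0 , Q-at-minus-one
  where
  Δ≢0 : Δ b c ≢ 0ℚ
  Δ≢0 = p*q≢0⇒p≢0 (F₁ b c) (p*q≢0⇒p≢0 (F₂ b c) Δ*F₁*F₂≢0)
  F₁≢0 : F₁ b c ≢ 0ℚ
  F₁≢0 = p*q≢0⇒q≢0 (Δ b c) (p*q≢0⇒p≢0 (F₂ b c) Δ*F₁*F₂≢0)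
  F₂≢0 : F₂ b c ≢ 0ℚ
  F₂≢0 = p*q≢0⇒q≢0 (Δ b c * F₁ b c) Δ*F₁*F₂≢0

  P-at-0 : eval (P b c) 0ℚ ≡ 0ℚ
  P-at-0 = trans (eval-cubic-at-0 (E₁₀ b c) (E₂₀ b c) (E₃₀ b c)) (cong -_ (E₃₀≡0 b c h≡0))

  Q-at-minus-one : eval (Q b c) (- 1ℚ) ≡ 0ℚ
  Q-at-minus-one = p*q≡0⇒p≡0
    (p*q≢0 (p*q≢0 (D≢0 b c h≡0) Δ≢0) (p*q≢0 (p*q≢0 F₁≢0 F₁≢0) (p*q≢0 F₂≢0 F₂≢0)))
    (trans (Q-at-minus-one-cleared b c (D≢0 b c h≡0) Δ≢0 F₁≢0 F₂≢0) (p≡0⇒p*q≡0 _ h≡0))
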